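{- Let $n \geq 1$ and let $G_n$ be the strip graph. For all $0 \leq k \leq n$, $\kappa_{1,k}(G_n) = F_k F_{2n-k}$, where $F_m$ is the $m$th Fibonacci number ($F_0=0,F_1=1$).
   Context: The strip graph $G_n$ has vertices $v_0,\ldots,v_n$ and an edge between $v_i$ and $v_j$ exactly when $|i-j|\in\{1,2\}$. $\kappa_{i,j}(G)$ is the number of 2-component spanning forests of $G$ in which one component contains $v_0$ and the other contains both $v_i$ and $v_j$. -}

module Defs where

open import Data.Nat using (ℕ; zero; suc; _+_; _*_; _∸_; _≡ᵇ_; _<ᵇ_)
open import Data.Bool using (Bool; true; false; _∧_; _∨_; not; if_then_else_)
open import Data.List using (List; []; _∷_; _++_; map; length; filterᵇ; upTo)
open import Data.Bool.ListAction using (any; all)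
open import Data.Product using (_×_; _,_; proj₁; proj₂)

fib : ℕ → ℕ
fib zero = 0
fib (suc zero) = 1
fib (suc (suc m)) = fib (suc m) + fib m

-- Vertices of G n are the naturals 0 .. n (v_i is i).
-- Edge list of the strip graph G n: {i, j} with |i - j| ∈ {1, 2}, 0 ≤ i, j ≤ n.
Edge : Set
Edge = ℕ × ℕ

edges : ℕ → List Edge
edges n = map (λ i → (i , suc i)) (upTo n)
       ++ map (λ i → (i , suc (suc i))) (upTo (n ∸ 1))

sublists : {A : Set} → List A → List (List A)
sublists [] = [] ∷ []
sublists (x ∷ xs) = let r = sublists xs in r ++ map (x ∷_) r

step : List Edge → (ℕ → Bool) → ℕ → Bool
step E S v = S v ∨ any (λ e → (S (proj₁ e) ∧ (proj₂ e ≡ᵇ v)) ∨ (S (proj₂ e) ∧ (proj₁ e ≡ᵇ v))) E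

iter : ℕ → List Edge → (ℕ → Bool) → ℕ → Bool
iter zero E S = S
iter (suc m) E S = iter m E (step E S)

-- conn n E a b : a and b lie in the same connected component of the
-- spanning subgraph of G n with edge set E (n + 1 vertices, so n + 1
-- closure steps reach the fixpoint).
conn : ℕ → List Edge → ℕ → ℕ → Bool
conn n E a b = iter (suc n) E (λ v → v ≡ᵇ a) b

removeAt : {A : Set} → ℕ → List A → List A
removeAt _ [] = []
removeAt zero (x ∷ xs) = xs
removeAt (suc k) (x ∷ xs) = x ∷ removeAt k xs

-- E is acyclic (a forest): no edge of E lies on a cycle, i.e. for every
-- edge of E its endpoints are disconnected once that edge is deleted.
acyclic : ℕ → List Edge → Bool
acyclic n E = all (λ k → acycAt k) (upTo (length E))
  where
  nth : ℕ → List Edge → Edge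
  nth _ [] = (0 , 0)
  nth zero (x ∷ _) = x
  nth (suc k) (_ ∷ xs) = nth k xs
  acycAt : ℕ → Bool
  acycAt k = not (conn n (removeAt k E) (proj₁ (nth k E)) (proj₂ (nth k E)))

-- E (a set of edges of G n) is a 2-component spanning forest in which one
-- component contains v_0 and the other contains v_i and v_j:
-- acyclic; v_0 and v_i in different components; v_i, v_j in the same
-- component; every vertex lies in the component of v_0 or of v_i
-- (so there are exactly two components).
good : ℕ → ℕ → ℕ → List Edge → Bool
good n i j E =
  acyclic n E ∧ not (conn n E 0 i) ∧ conn n E i j
  ∧ all (λ w → conn n E 0 w ∨ conn n E i w) (upTo (suc n))

kappa : ℕ → ℕ → ℕ → ℕ
kappa n i j = length (filterᵇ (good n i j) (sublists (edges n)))

-- Order the edges of G_n so that the two edges at the last vertex v_n come first, and sort the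
-- forests by which of them they contain. With neither, v_n is isolated and the forest is not
-- counted. With only v_t v_n, the vertex v_n is a leaf; deleting it leaves a forest of G_(n-1)
-- of the same kind, with v_t in place of v_k if k = n. With both, contracting v_(n-1) v_n leaves
-- such a forest of G_(n-1) that contains v_(n-2) v_(n-1). Hence a_n(k) = κ_(1,k)(G_n) and the
-- number b_n(k) of its forests through v_(n-1) v_n satisfy a_n = a_(n-1) + b_n and
-- b_n = a_(n-1) + b_(n-1) at the relabelled k, as do F_k F_(2n-k) and F_k F_(2n-k-1).
--
-- On the Boolean side, `conn` decides reachability because each of its n + 1 closure rounds
-- either adds one of the n + 1 vertices or has already closed up, and `acyclic` holds iff every
-- edge joins two components of the edges after it.

module Submission where

open import Defs
open import Data.Nat using (ℕ; _≤_; _*_; _∸_)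
open import Relation.Binary.PropositionalEquality using (_≡_)

open import Data.Bool using (Bool; true; false; T; T?; not; _∧_; _∨_; if_then_else_)
open import Data.Bool.ListAction using (all; and)
open import Data.Bool.Properties using (T-∧; T-∨)
open import Data.Empty using (⊥-elim)
open import Data.List using (List; []; _∷_; _++_; _∷ʳ_; length; upTo; applyUpTo; map; filterᵇ)
open import Data.List.Membership.Propositional using (_∈_; find; lose)
open import Data.List.Properties using (map-applyUpTo; map-upTo; filter-++; length-++; map-++; upTo-∷ʳ)
open import Data.List.Relation.Binary.Permutation.Propositional as ↭ using (_↭_; prep; swap; ↭-sym)
open import Data.List.Relation.Binary.Permutation.Propositional.Properties
  using (∈-resp-↭; All-resp-↭; ++⁺; ∷↭∷ʳ; shift)
open import Data.List.Relation.Binary.Subset.Propositional using (_⊆_)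
open import Data.List.Relation.Unary.All as All using (All; []; _∷_)
open import Data.List.Relation.Unary.All.Properties using (anti-mono; all⁺; all⁻; applyUpTo⁺₁; applyUpTo⁻)
open import Data.List.Relation.Unary.Any using (here; there)
open import Data.List.Relation.Unary.Any.Properties using (any⁺; any⁻)
open import Data.Nat
  using (_+_; _<_; _≤′_; _≡ᵇ_; _≤?_; zero; suc; pred; s≤s; s≤s⁻¹; z≤n; z<s; ≤′-refl; ≤′-step)
open import Data.Nat.Properties
  using ( _≟_; +-commutativeSemigroup; +-identityʳ; +-comm; *-comm; *-suc; *-distribˡ-+; +-∸-assoc
        ; m+n∸m≡n; m<n⇒0<n∸m; ≤-<-trans; m<m+n; m≤m+n; ≡ᵇ⇒≡; ≡⇒≡ᵇ; ≤⇒≤′; ≤-refl; ≤-trans; n≤1+n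
        ; <-irrefl; ≰⇒>; m<n⇒m<1+n; m≤n⇒m≤1+n; ≤∧≢⇒< )
open import Algebra.Properties.CommutativeSemigroup +-commutativeSemigroup using (interchange)
open import Data.Product using (_×_; _,_; proj₁; proj₂; ∃-syntax)
open import Data.Product.Function.NonDependent.Propositional using (_×-⇔_)
open import Data.Sum as Sum using (_⊎_; inj₁; inj₂)
open import Data.Sum.Function.Propositional using (_⊎-⇔_)
open import Data.Unit using (⊤)
open import Function using (id; _∘_; _⇔_; mk⇔; Equivalence)
open import Function.Construct.Composition using (_⇔-∘_)
open import Relation.Binary.Construct.Closure.ReflexiveTransitive as Star
  using (Star; ε; _◅_; _◅◅_; reverse; kleisliStar)
open import Relation.Binary.PropositionalEquality
  using (_≢_; refl; sym; trans; cong; cong₂; subst; subst₂; module ≡-Reasoning)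
open import Relation.Nullary using (¬_; yes; no)

open Equivalence using (to; from)

T-ext : ∀ {x y} → (T x → T y) → (T y → T x) → x ≡ y
T-ext {false} {false} _ _ = refl
T-ext {false} {true}  _ g = ⊥-elim (g _)
T-ext {true}  {false} f _ = ⊥-elim (f _)
T-ext {true}  {true}  _ _ = refl

T-≡ : ∀ {x y} {P Q : Set} → T x ⇔ P → T y ⇔ Q → P ⇔ Q → x ≡ y
T-≡ x⇔P y⇔Q P⇔Q = T-ext (from y⇔Q ∘ to P⇔Q ∘ to x⇔P) (from x⇔P ∘ from P⇔Q ∘ to y⇔Q)

T-not : ∀ {b} → T (not b) ⇔ (¬ T b)
T-not {false} = mk⇔ (λ _ ()) (λ _ → _)
T-not {true}  = mk⇔ (λ ()) (λ ¬t → ¬t _)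

∧-congˡ-if : ∀ a {x y} → (T a → x ≡ y) → a ∧ x ≡ a ∧ y
∧-congˡ-if false _    = refl
∧-congˡ-if true  x≡y = x≡y _


-- Reachability

Adjacent : List Edge → ℕ → ℕ → Set
Adjacent E u v = (u , v) ∈ E ⊎ (v , u) ∈ E

Reach : List Edge → ℕ → ℕ → Set
Reach E = Star (Adjacent E)

reach-sym : ∀ {E u v} → Reach E u v → Reach E v u
reach-sym = reverse Sum.swap

reach-mono : ∀ {E E′ u v} → E ⊆ E′ → Reach E u v → Reach E′ u v
reach-mono E⊆E′ = Star.map (Sum.map E⊆E′ E⊆E′)

edge-reach : ∀ {E e} → e ∈ E → Reach E (proj₁ e) (proj₂ e)
edge-reach e∈E = inj₁ e∈E ◅ ε

Touches : List Edge → Edge → ℕ → Set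
Touches E (a , b) u = Reach E u a ⊎ Reach E u b

adjacent-∷⁻ : ∀ {e E u v} → Adjacent (e ∷ E) u v → Adjacent E u v ⊎ ((u , v) ≡ e ⊎ (v , u) ≡ e)
adjacent-∷⁻ (inj₁ (here uv≡e))  = inj₂ (inj₁ uv≡e)
adjacent-∷⁻ (inj₂ (here vu≡e))  = inj₂ (inj₂ vu≡e)
adjacent-∷⁻ (inj₁ (there uv∈E)) = inj₁ (inj₁ uv∈E)
adjacent-∷⁻ (inj₂ (there vu∈E)) = inj₁ (inj₂ vu∈E)

reach-∷⁻ : ∀ {e E u v} → Reach (e ∷ E) u v → Reach E u v ⊎ (Touches E e u × Touches E e v)
reach-∷⁻ ε = inj₁ ε
reach-∷⁻ (hop ◅ path) with adjacent-∷⁻ hop | reach-∷⁻ path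
... | inj₁ adj         | inj₁ rest      = inj₁ (adj ◅ rest)
... | inj₁ adj         | inj₂ (tw , tv) = inj₂ (Sum.map (adj ◅_) (adj ◅_) tw , tv)
... | inj₂ (inj₁ refl) | inj₁ rest      = inj₂ (inj₁ ε , inj₂ (reach-sym rest))
... | inj₂ (inj₁ refl) | inj₂ (_ , tv)  = inj₂ (inj₁ ε , tv)
... | inj₂ (inj₂ refl) | inj₁ rest      = inj₂ (inj₂ ε , inj₁ (reach-sym rest))
... | inj₂ (inj₂ refl) | inj₂ (_ , tv)  = inj₂ (inj₂ ε , tv)

reach-exchange : ∀ {e E u v} → Reach (e ∷ E) u v → Reach E u v ⊎ Reach ((u , v) ∷ E) (proj₁ e) (proj₂ e)
reach-exchange path with reach-∷⁻ path
... | inj₁ p = inj₁ p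
... | inj₂ (inj₁ ua , inj₁ va) = inj₁ (ua ◅◅ reach-sym va)
... | inj₂ (inj₂ ub , inj₂ vb) = inj₁ (ub ◅◅ reach-sym vb)
... | inj₂ (inj₁ ua , inj₂ vb) =
  inj₂ (reach-mono there (reach-sym ua) ◅◅ inj₁ (here refl) ◅ reach-mono there vb)
... | inj₂ (inj₂ ub , inj₁ va) =
  inj₂ (reach-mono there (reach-sym va) ◅◅ inj₂ (here refl) ◅ reach-mono there ub)

BoundedEdge : ℕ → Edge → Set
BoundedEdge n e = proj₁ e ≤ n × proj₂ e ≤ n

Bounded : ℕ → List Edge → Set
Bounded n = All (BoundedEdge n)

bounded-weaken : ∀ {n n′ E} → n ≤ n′ → Bounded n E → Bounded n′ E
bounded-weaken n≤n′ = All.map λ (a≤n , b≤n) → ≤-trans a≤n n≤n′ , ≤-trans b≤n n≤n′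

leaf-bounded : ∀ {M u E} → u ≤ M → Bounded M E → Bounded (suc M) ((u , suc M) ∷ E)
leaf-bounded u≤M B = (≤-trans u≤M (n≤1+n _) , ≤-refl) ∷ bounded-weaken (n≤1+n _) B

adjacent-≤ : ∀ {n E u v} → Bounded n E → Adjacent E u v → v ≤ n
adjacent-≤ B (inj₁ uv∈E) = proj₂ (All.lookup B uv∈E)
adjacent-≤ B (inj₂ vu∈E) = proj₁ (All.lookup B vu∈E)

reach-≤ : ∀ {n E a b} → Bounded n E → Reach E a b → b ≡ a ⊎ b ≤ n
reach-≤ B ε = inj₁ refl
reach-≤ B (hop ◅ path) with reach-≤ B path
... | inj₁ refl = inj₂ (adjacent-≤ B hop)
... | inj₂ b≤n  = inj₂ b≤n

fresh-unreachable : ∀ {M E u} → Bounded M E → u ≤ M → ¬ Reach E u (suc M)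
fresh-unreachable B u≤M u⇝ with reach-≤ B u⇝
... | inj₁ refl = <-irrefl refl (s≤s u≤M)
... | inj₂ N≤M  = <-irrefl refl N≤M


-- conn decides reachability

step-sound : ∀ E S v → T (step E S v) → T (S v) ⊎ ∃[ u ] T (S u) × Adjacent E u v
step-sound E S v t with to T-∨ t
... | inj₁ Sv = inj₁ Sv
... | inj₂ t′ with find (any⁻ _ E t′)
...   | (a , b) , ab∈E , t″ with to T-∨ t″
...     | inj₁ t‴ = let Sa , b≡v = to T-∧ t‴ in
                    inj₂ (a , Sa , inj₁ (subst (λ w → (a , w) ∈ E) (≡ᵇ⇒≡ b v b≡v) ab∈E))
...     | inj₂ t‴ = let Sb , a≡v = to T-∧ t‴ in
                    inj₂ (b , Sb , inj₂ (subst (λ w → (w , b) ∈ E) (≡ᵇ⇒≡ a v a≡v) ab∈E))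

step-adjacent : ∀ E S {u v} → Adjacent E u v → T (S u) → T (step E S v)
step-adjacent E S {u} {v} (inj₁ uv∈E) Su =
  from T-∨ (inj₂ (any⁺ _ (lose uv∈E (from T-∨ (inj₁ (from T-∧ (Su , ≡⇒≡ᵇ v v refl)))))))
step-adjacent E S {u} {v} (inj₂ vu∈E) Su =
  from T-∨ (inj₂ (any⁺ _ (lose vu∈E (from T-∨ (inj₂ (from T-∧ (Su , ≡⇒≡ᵇ v v refl)))))))

step-extensive : ∀ E S v → T (S v) → T (step E S v)
step-extensive E S v Sv = from T-∨ (inj₁ Sv)

iter-sound : ∀ m E S v → T (iter m E S v) → ∃[ u ] T (S u) × Reach E u v
iter-sound zero    E S v Sv = v , Sv , ε
iter-sound (suc m) E S v t with iter-sound m E (step E S) v t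
... | u , t′ , u⇝v with step-sound E S u t′
...   | inj₁ Su = u , Su , u⇝v
...   | inj₂ (w , Sw , w~u) = w , Sw , w~u ◅ u⇝v

conn-sound : ∀ n E a b → T (conn n E a b) → Reach E a b
conn-sound n E a b t with iter-sound (suc n) E (_≡ᵇ a) b t
... | u , u≡a , u⇝b = subst (λ w → Reach E w b) (≡ᵇ⇒≡ u a u≡a) u⇝b

iter-suc : ∀ m E S → iter (suc m) E S ≡ step E (iter m E S)
iter-suc zero    E S = refl
iter-suc (suc m) E S = iter-suc m E (step E S)

iter-mono : ∀ {m m′} E S v → m ≤ m′ → T (iter m E S v) → T (iter m′ E S v)
iter-mono {m} E S v m≤m′ = go (≤⇒≤′ m≤m′)
  where
  go : ∀ {m′} → m ≤′ m′ → T (iter m E S v) → T (iter m′ E S v)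
  go ≤′-refl t = t
  go (≤′-step {m′} m≤′m′) t =
    subst (λ S′ → T (S′ v)) (sym (iter-suc m′ E S)) (step-extensive E (iter m′ E S) v (go m≤′m′ t))

source-reached : ∀ m E a → T (iter m E (_≡ᵇ a) a)
source-reached m E a = iter-mono {0} {m} E (_≡ᵇ a) a z≤n (≡⇒≡ᵇ a a refl)

closed-reach : ∀ {n E S u w} → Bounded n E → (∀ v → v ≤ n → T (step E S v) → T (S v)) →
               Reach E u w → T (S u) → T (S w)
closed-reach B closed ε Su = Su
closed-reach {E = E} {S} B closed (hop ◅ path) Su =
  closed-reach B closed path (closed _ (adjacent-≤ B hop) (step-adjacent E S hop Su))

countBelow : (ℕ → Bool) → ℕ → ℕ
countBelow S zero    = 0
countBelow S (suc K) = if S K then suc (countBelow S K) else countBelow S K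

_⊆[_]_ : (ℕ → Bool) → ℕ → (ℕ → Bool) → Set
S ⊆[ K ] S′ = ∀ v → v < K → T (S v) → T (S′ v)

⊆[]-pred : ∀ {S K S′} → S ⊆[ suc K ] S′ → S ⊆[ K ] S′
⊆[]-pred S⊆S′ v v<K = S⊆S′ v (m<n⇒m<1+n v<K)

countBelow-mono : ∀ {S S′} K → S ⊆[ K ] S′ → countBelow S K ≤ countBelow S′ K
countBelow-mono zero _ = z≤n
countBelow-mono {S} {S′} (suc K) S⊆S′ with S K in eS | S′ K in eS′
... | true  | true  = s≤s (countBelow-mono K (⊆[]-pred S⊆S′))
... | true  | false = ⊥-elim (subst T eS′ (S⊆S′ K ≤-refl (subst T (sym eS) _)))
... | false | true  = m≤n⇒m≤1+n (countBelow-mono K (⊆[]-pred S⊆S′))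
... | false | false = countBelow-mono K (⊆[]-pred S⊆S′)

countBelow-stable : ∀ {S S′} K → S ⊆[ K ] S′ → countBelow S′ K ≤ countBelow S K → S′ ⊆[ K ] S
countBelow-stable {S} {S′} (suc K) S⊆S′ c′≤c v v<1+K S′v with S K in eS | S′ K in eS′ | v ≟ K
... | true  | false | _ = ⊥-elim (subst T eS′ (S⊆S′ K ≤-refl (subst T (sym eS) _)))
... | false | true  | _ = ⊥-elim (<-irrefl refl (≤-trans c′≤c (countBelow-mono K (⊆[]-pred S⊆S′))))
... | true  | true  | yes refl = subst T (sym eS) _
... | false | false | yes refl = ⊥-elim (subst T eS′ S′v)
... | true  | true  | no v≢K =
  countBelow-stable K (⊆[]-pred S⊆S′) (s≤s⁻¹ c′≤c) v (≤∧≢⇒< (s≤s⁻¹ v<1+K) v≢K) S′v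
... | false | false | no v≢K =
  countBelow-stable K (⊆[]-pred S⊆S′) c′≤c v (≤∧≢⇒< (s≤s⁻¹ v<1+K) v≢K) S′v

countBelow-true : ∀ K → countBelow (λ _ → true) K ≡ K
countBelow-true zero    = refl
countBelow-true (suc K) = cong suc (countBelow-true K)

countBelow-full : ∀ {S} K → K ≤ countBelow S K → ∀ v → v < K → T (S v)
countBelow-full {S} K K≤c v v<K =
  countBelow-stable K (λ _ _ _ → _) (subst (_≤ countBelow S K) (sym (countBelow-true K)) K≤c) v v<K _

closed-or-grows : ∀ {n E a b} → Bounded n E → Reach E a b → ∀ S → T (S a) →
                  T (S b) ⊎ countBelow S (suc n) < countBelow (step E S) (suc n)
closed-or-grows {n} {E} B a⇝b S Sa with countBelow (step E S) (suc n) ≤? countBelow S (suc n)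
... | yes stable = inj₁ (closed-reach B closed a⇝b Sa)
  where
  closed : ∀ v → v ≤ n → T (step E S v) → T (S v)
  closed v v≤n = countBelow-stable (suc n) (λ w _ → step-extensive E S w) stable v (s≤s v≤n)
... | no grows = inj₂ (≰⇒> grows)

-- n + 1 rounds of growth would put all of 0 … n into the reached set.
saturation : ∀ {n E a b} → Bounded n E → Reach E a b → ∀ m → m ≤ suc n →
             T (iter (suc n) E (_≡ᵇ a) b) ⊎ m ≤ countBelow (iter m E (_≡ᵇ a)) (suc n)
saturation B a⇝b zero _ = inj₂ z≤n
saturation {n} {E} {a} {b} B a⇝b (suc m) 1+m≤1+n with saturation B a⇝b m (≤-trans (n≤1+n m) 1+m≤1+n)
... | inj₁ done = inj₁ done
... | inj₂ m≤c with closed-or-grows B a⇝b (iter m E (_≡ᵇ a)) (source-reached m E a)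
...   | inj₁ b∈ = inj₁ (iter-mono E (_≡ᵇ a) b (≤-trans (n≤1+n m) 1+m≤1+n) b∈)
...   | inj₂ grows =
  inj₂ (subst (λ S → suc m ≤ countBelow S (suc n)) (sym (iter-suc m E (_≡ᵇ a))) (≤-trans (s≤s m≤c) grows))

conn-complete : ∀ {n E a b} → Bounded n E → Reach E a b → T (conn n E a b)
conn-complete {n} {E} {a} {b} B a⇝b with saturation B a⇝b (suc n) ≤-refl
... | inj₁ done = done
... | inj₂ full with reach-≤ B a⇝b
...   | inj₁ refl = source-reached (suc n) E a
...   | inj₂ b≤n  = countBelow-full (suc n) full b (s≤s b≤n)

conn-correct : ∀ {n E a b} → Bounded n E → T (conn n E a b) ⇔ Reach E a b
conn-correct {n} {E} {a} {b} B = mk⇔ (conn-sound n E a b) (conn-complete B)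

not-conn-correct : ∀ {n E a b} → Bounded n E → T (not (conn n E a b)) ⇔ (¬ Reach E a b)
not-conn-correct B = mk⇔ (λ t a⇝b → to T-not t (from (conn-correct B) a⇝b))
                         (λ ¬a⇝b → from T-not (¬a⇝b ∘ to (conn-correct B)))

conn-≡ : ∀ {n n′ E E′ a b a′ b′} → Bounded n E → Bounded n′ E′ →
         (Reach E a b ⇔ Reach E′ a′ b′) → conn n E a b ≡ conn n′ E′ a′ b′
conn-≡ B B′ = T-≡ (conn-correct B) (conn-correct B′)


-- acyclic and good as graph properties

private
  unfold-at : ∀ {g : ℕ → Bool} {m} → all g (upTo m) ≡ all g (upTo m) → ∀ k → g k ≡ g k
  unfold-at _ _ = refl

-- `acyclic` looks edges up with a function local to its `where` block. `edgeAt` is that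
-- function: its body is left to unification, which `edgeAt-determined` forces by exposing
-- the local function applied to distinct variables.
mutual
  edgeAt : ℕ → List Edge → ℕ → List Edge → Edge
  edgeAt n E k L = _

  private
    edgeAt-determined : ∀ n e E k →
      not (conn n (e ∷ removeAt k E) (proj₁ (edgeAt n (e ∷ E) k E)) (proj₂ (edgeAt n (e ∷ E) k E))) ≡
      not (conn n (e ∷ removeAt k E) (proj₁ (edgeAt n (e ∷ E) k E)) (proj₂ (edgeAt n (e ∷ E) k E)))
    edgeAt-determined n e E k
      with e ∷ E | unfold-at {m = suc (length E)} (refl {x = acyclic n (e ∷ E)}) (suc k)
    ... | _ | unfolded = unfolded

edgeAt-∈ : ∀ n E k L → k < length L → edgeAt n E k L ∈ L
edgeAt-∈ n E zero    (f ∷ L) _         = here refl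
edgeAt-∈ n E (suc k) (f ∷ L) (s≤s k<l) = there (edgeAt-∈ n E k L k<l)

edgeAt-irrelevant : ∀ n E E′ k L → edgeAt n E k L ≡ edgeAt n E′ k L
edgeAt-irrelevant n E E′ k       []      = refl
edgeAt-irrelevant n E E′ zero    (f ∷ L) = refl
edgeAt-irrelevant n E E′ (suc k) (f ∷ L) = edgeAt-irrelevant n E E′ k L

removeAt-⊆ : ∀ k (L : List Edge) → removeAt k L ⊆ L
removeAt-⊆ zero    (f ∷ L) f′∈       = there f′∈
removeAt-⊆ (suc k) (f ∷ L) (here eq) = here eq
removeAt-⊆ (suc k) (f ∷ L) (there f′∈) = there (removeAt-⊆ k L f′∈)

bridgeAt : ℕ → List Edge → ℕ → Bool
bridgeAt n E k = not (conn n (removeAt k E) (proj₁ (edgeAt n E k E)) (proj₂ (edgeAt n E k E)))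

applyUpTo-cong< : ∀ {A : Set} {f g : ℕ → A} n → (∀ {k} → k < n → f k ≡ g k) → applyUpTo f n ≡ applyUpTo g n
applyUpTo-cong< zero    _   = refl
applyUpTo-cong< (suc n) f≗g = cong₂ _∷_ (f≗g (s≤s z≤n)) (applyUpTo-cong< n (f≗g ∘ s≤s))

conn-∷-irrelevant : ∀ {n e E R f} → Bounded n (e ∷ E) → ¬ Reach E (proj₁ e) (proj₂ e) → R ⊆ E → f ∈ E →
                    conn n (e ∷ R) (proj₁ f) (proj₂ f) ≡ conn n R (proj₁ f) (proj₂ f)
conn-∷-irrelevant {e = e} {E} {R} {f} (be ∷ B) ¬e⇝ R⊆E f∈E =
  conn-≡ (be ∷ anti-mono R⊆E B) (anti-mono R⊆E B) (mk⇔ drop-e (reach-mono there))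
  where
  f∷R⊆E : f ∷ R ⊆ E
  f∷R⊆E (here refl) = f∈E
  f∷R⊆E (there g∈R) = R⊆E g∈R
  drop-e : Reach (e ∷ R) (proj₁ f) (proj₂ f) → Reach R (proj₁ f) (proj₂ f)
  drop-e f⇝ with reach-exchange f⇝
  ... | inj₁ f⇝′ = f⇝′
  ... | inj₂ e⇝ = ⊥-elim (¬e⇝ (reach-mono f∷R⊆E e⇝))

acyclic-∷ : ∀ {n e E} → Bounded n (e ∷ E) →
            acyclic n (e ∷ E) ≡ not (conn n E (proj₁ e) (proj₂ e)) ∧ acyclic n E
acyclic-∷ {n} {e} {E} B@(_ ∷ B′) = ∧-congˡ-if (not (conn n E (proj₁ e) (proj₂ e))) λ e-bridge → begin
    and (map (bridgeAt n (e ∷ E)) (applyUpTo suc (length E)))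
  ≡⟨ cong and (map-applyUpTo suc (bridgeAt n (e ∷ E)) (length E)) ⟩
    and (applyUpTo (bridgeAt n (e ∷ E) ∘ suc) (length E))
  ≡⟨ cong and (applyUpTo-cong< (length E) (still-bridge (to (not-conn-correct B′) e-bridge))) ⟩
    and (applyUpTo (bridgeAt n E) (length E))
  ≡⟨ cong and (sym (map-upTo (bridgeAt n E) (length E))) ⟩
    acyclic n E ∎
  where
  open ≡-Reasoning
  still-bridge : ¬ Reach E (proj₁ e) (proj₂ e) → ∀ {k} → k < length E →
                 bridgeAt n (e ∷ E) (suc k) ≡ bridgeAt n E k
  still-bridge ¬e⇝ {k} k<l = cong not (trans
    (cong (λ f → conn n (e ∷ removeAt k E) (proj₁ f) (proj₂ f)) (edgeAt-irrelevant n (e ∷ E) E k E))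
    (conn-∷-irrelevant B ¬e⇝ (removeAt-⊆ k E) (edgeAt-∈ n E k E k<l)))

IsForest : List Edge → Set
IsForest []      = ⊤
IsForest (e ∷ E) = ¬ Reach E (proj₁ e) (proj₂ e) × IsForest E

acyclic-correct : ∀ {n E} → Bounded n E → T (acyclic n E) ⇔ IsForest E
acyclic-correct [] = mk⇔ _ _
acyclic-correct {n} {e ∷ E} B@(_ ∷ B′) =
  subst (λ b → T b ⇔ IsForest (e ∷ E)) (sym (acyclic-∷ B))
        ((not-conn-correct B′ ×-⇔ acyclic-correct B′) ⇔-∘ T-∧)

Good : ℕ → ℕ → ℕ → List Edge → Set
Good n i j E = IsForest E × ¬ Reach E 0 i × Reach E i j × (∀ w → w ≤ n → Reach E 0 w ⊎ Reach E i w)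

T-all-upTo-suc : ∀ (p : ℕ → Bool) n → T (all p (upTo (suc n))) ⇔ (∀ w → w ≤ n → T (p w))
T-all-upTo-suc p n = mk⇔ (λ t w w≤n → applyUpTo⁻ id (suc n) (all⁺ p _ t) (s≤s w≤n))
                         (λ h → all⁻ p (applyUpTo⁺₁ id (suc n) (h _ ∘ s≤s⁻¹)))

∀≤-cong : ∀ {n} {P Q : ℕ → Set} → (∀ w → P w ⇔ Q w) → (∀ w → w ≤ n → P w) ⇔ (∀ w → w ≤ n → Q w)
∀≤-cong P⇔Q = mk⇔ (λ h w w≤n → to (P⇔Q w) (h w w≤n)) (λ h w w≤n → from (P⇔Q w) (h w w≤n))

good-correct : ∀ {n i j E} → Bounded n E → T (good n i j E) ⇔ Good n i j E
good-correct {n} {i} {j} {E} B =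
  (acyclic-correct B ×-⇔ (not-conn-correct B ×-⇔ (conn-correct B ×-⇔ covers) ⇔-∘ T-∧) ⇔-∘ T-∧) ⇔-∘ T-∧
  where
  covers : T (all (λ w → conn n E 0 w ∨ conn n E i w) (upTo (suc n))) ⇔
           (∀ w → w ≤ n → Reach E 0 w ⊎ Reach E i w)
  covers = ∀≤-cong (λ w → (conn-correct B ⊎-⇔ conn-correct B) ⇔-∘ T-∨) ⇔-∘ T-all-upTo-suc _ n

good-≡ : ∀ {n n′ i i′ j j′ E E′} → Bounded n E → Bounded n′ E′ →
         Good n i j E ⇔ Good n′ i′ j′ E′ → good n i j E ≡ good n′ i′ j′ E′
good-≡ B B′ = T-≡ (good-correct B) (good-correct B′)

good-false : ∀ {n i j E} → Bounded n E → ¬ Good n i j E → good n i j E ≡ false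
good-false B ¬G = T-ext (¬G ∘ to (good-correct B)) (λ ())


-- Reordering edges, deleting a leaf, contracting an edge

reach-↭ : ∀ {E E′ u v} → E ↭ E′ → Reach E u v → Reach E′ u v
reach-↭ E↭E′ = reach-mono (∈-resp-↭ E↭E′)

forest-↭ : ∀ {E E′} → E ↭ E′ → IsForest E → IsForest E′
forest-↭ ↭.refl F = F
forest-↭ (prep e E↭E′) (¬e⇝ , F) = ¬e⇝ ∘ reach-↭ (↭-sym E↭E′) , forest-↭ E↭E′ F
forest-↭ {x ∷ y ∷ E} {y ∷ x ∷ E′} (swap x y E↭E′) (¬x⇝ , ¬y⇝ , F) = ¬y⇝′ , ¬x⇝ ∘ there-↭ , forest-↭ E↭E′ F
  where
  there-↭ : ∀ {u v} → Reach E′ u v → Reach (y ∷ E) u v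
  there-↭ = reach-mono there ∘ reach-↭ (↭-sym E↭E′)
  ¬y⇝′ : ¬ Reach (x ∷ E′) (proj₁ y) (proj₂ y)
  ¬y⇝′ y⇝ with reach-exchange (reach-↭ (prep x (↭-sym E↭E′)) y⇝)
  ... | inj₁ y⇝E = ¬y⇝ y⇝E
  ... | inj₂ x⇝ = ¬x⇝ x⇝
forest-↭ (↭.trans E↭E′ E′↭E″) = forest-↭ E′↭E″ ∘ forest-↭ E↭E′

good-↭ : ∀ {n i j E E′} → E ↭ E′ → Good n i j E → Good n i j E′
good-↭ E↭E′ (F , ¬0⇝i , i⇝j , cover) =
  forest-↭ E↭E′ F , ¬0⇝i ∘ reach-↭ (↭-sym E↭E′) , reach-↭ E↭E′ i⇝j ,
  λ w w≤n → Sum.map (reach-↭ E↭E′) (reach-↭ E↭E′) (cover w w≤n)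

isolated-not-good : ∀ {M i j E} → Bounded M E → i ≤ M → ¬ Good (suc M) i j E
isolated-not-good {M} B i≤M (_ , _ , _ , cover) with cover (suc M) ≤-refl
... | inj₁ 0⇝ = fresh-unreachable B z≤n 0⇝
... | inj₂ i⇝ = fresh-unreachable B i≤M i⇝

doubled-not-forest : ∀ {e E} → ¬ IsForest (e ∷ e ∷ E)
doubled-not-forest (¬e⇝ , _) = ¬e⇝ (edge-reach (here refl))

merge : ℕ → ℕ → ℕ → ℕ
merge N t v = if v ≡ᵇ N then t else v

≡ᵇ-true⇒≡ : ∀ {v N} → (v ≡ᵇ N) ≡ true → v ≡ N
≡ᵇ-true⇒≡ {v} {N} eq = ≡ᵇ⇒≡ v N (subst T (sym eq) _)

≡ᵇ-false⇒≢ : ∀ {v N} → (v ≡ᵇ N) ≡ false → v ≢ N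
≡ᵇ-false⇒≢ {v} {N} eq v≡N = subst T eq (≡⇒≡ᵇ v N v≡N)

merge-target : ∀ N t → merge N t N ≡ t
merge-target N t with N ≡ᵇ N in eq
... | true  = refl
... | false = ⊥-elim (≡ᵇ-false⇒≢ {N} eq refl)

merge-fixed : ∀ {N t v} → v < N → merge N t v ≡ v
merge-fixed {N} {v = v} v<N with v ≡ᵇ N in eq
... | true  = ⊥-elim (<-irrefl (≡ᵇ-true⇒≡ eq) v<N)
... | false = refl

merge-≤ : ∀ {M t w} → t ≤ M → w ≤ suc M → merge (suc M) t w ≤ M
merge-≤ {M} {w = w} t≤M w≤N with w ≡ᵇ suc M in eq
... | true  = t≤M
... | false = s≤s⁻¹ (≤∧≢⇒< w≤N (≡ᵇ-false⇒≢ eq))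

-- As far as reachability goes, Y is X with the vertex N identified with t.
record Merges (N t : ℕ) (X Y : List Edge) : Set where
  field
    collapse : ∀ {u v} → Adjacent X u v → Reach Y (merge N t u) (merge N t v)
    expand   : ∀ {u v} → Adjacent Y u v → Reach X u v
    joined   : Reach X t N

merge-reach : ∀ {N t X Y} → Merges N t X Y → ∀ x y → Reach X x y ⇔ Reach Y (merge N t x) (merge N t y)
merge-reach {N} {t} {X} {Y} μ x y =
  mk⇔ (kleisliStar (merge N t) collapse)
      (λ x⇝y → to-merged x ◅◅ kleisliStar id expand x⇝y ◅◅ reach-sym (to-merged y))
  where
  open Merges μ
  to-merged : ∀ v → Reach X v (merge N t v)
  to-merged v with v ≡ᵇ N in eq
  ... | true  = subst (λ u → Reach X u t) (sym (≡ᵇ-true⇒≡ eq)) (reach-sym joined)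
  ... | false = ε

merge-reach-from : ∀ {N t X Y x} → Merges N t X Y → x < N → ∀ y → Reach X x y ⇔ Reach Y x (merge N t y)
merge-reach-from {x = x} μ x<N y = subst (λ x′ → _ ⇔ Reach _ x′ _) (merge-fixed x<N) (merge-reach μ x y)

good-merge : ∀ {M t i j X Y} → Merges (suc M) t X Y → t ≤ M → i ≤ M → (IsForest X ⇔ IsForest Y) →
             Good (suc M) i j X ⇔ Good M i (merge (suc M) t j) Y
good-merge {M} {t} {i} {j} {X} {Y} μ t≤M i≤M F⇔F = mk⇔ forward backward
  where
  via : ∀ {x} → x ≤ M → ∀ y → Reach X x y ⇔ Reach Y x (merge (suc M) t y)
  via x≤M = merge-reach-from μ (s≤s x≤M)
  fixed : ∀ {x y} → x ≤ M → y ≤ M → Reach X x y ⇔ Reach Y x y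
  fixed {x} {y} x≤M y≤M = subst (λ y′ → Reach X x y ⇔ Reach Y x y′) (merge-fixed (s≤s y≤M)) (via x≤M y)
  forward : Good (suc M) i j X → Good M i (merge (suc M) t j) Y
  forward (F , ¬0⇝i , i⇝j , cover) =
    to F⇔F F , ¬0⇝i ∘ from (fixed z≤n i≤M) , to (via i≤M j) i⇝j ,
    λ w w≤M → Sum.map (to (fixed z≤n w≤M)) (to (fixed i≤M w≤M)) (cover w (m≤n⇒m≤1+n w≤M))
  backward : Good M i (merge (suc M) t j) Y → Good (suc M) i j X
  backward (F , ¬0⇝i , i⇝j , cover) =
    from F⇔F F , ¬0⇝i ∘ to (fixed z≤n i≤M) , from (via i≤M j) i⇝j ,
    λ w w≤N → Sum.map (from (via z≤n w)) (from (via i≤M w)) (cover _ (merge-≤ t≤M w≤N))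

merge-adjacent : ∀ {M t E Y x y} → Bounded M E → E ⊆ Y → Adjacent E x y →
                 Reach Y (merge (suc M) t x) (merge (suc M) t y)
merge-adjacent {Y = Y} B E⊆Y xy =
  subst₂ (Reach Y) (sym (merge-fixed (s≤s (adjacent-≤ B (Sum.swap xy)))))
                   (sym (merge-fixed (s≤s (adjacent-≤ B xy))))
                   (Sum.map E⊆Y E⊆Y xy ◅ ε)

merged-ends : ∀ {N t Y} → t < N → Reach Y (merge N t t) (merge N t N)
merged-ends {N} {t} t<N = subst (Star _ (merge N t t)) (trans (merge-fixed t<N) (sym (merge-target N t))) ε

leaf-merges : ∀ {M u E} → Bounded M E → u ≤ M → Merges (suc M) u ((u , suc M) ∷ E) E
leaf-merges {M} {u} {E} B u≤M = record
  { collapse = collapse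
  ; expand   = λ xy → Sum.map there there xy ◅ ε
  ; joined   = edge-reach (here refl)
  }
  where
  collapse : ∀ {x y} → Adjacent ((u , suc M) ∷ E) x y → Reach E (merge (suc M) u x) (merge (suc M) u y)
  collapse xy with adjacent-∷⁻ xy
  ... | inj₁ xy′          = merge-adjacent B id xy′
  ... | inj₂ (inj₁ refl) = merged-ends (s≤s u≤M)
  ... | inj₂ (inj₂ refl) = reach-sym (merged-ends (s≤s u≤M))

contraction-merges : ∀ {m E} → Bounded (suc m) E →
  Merges (suc (suc m)) (suc m) ((suc m , suc (suc m)) ∷ (m , suc (suc m)) ∷ E) ((m , suc m) ∷ E)
contraction-merges {m} {E} B = record
  { collapse = collapse
  ; expand   = expand
  ; joined   = edge-reach (here refl)
  }
  where
  M = suc m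
  N = suc M
  m⇝M : Reach ((m , M) ∷ E) (merge N M m) (merge N M N)
  m⇝M = subst₂ (Reach _) (sym (merge-fixed (s≤s (n≤1+n m)))) (sym (merge-target N M)) (edge-reach (here refl))
  collapse : ∀ {x y} → Adjacent ((M , N) ∷ (m , N) ∷ E) x y → Reach ((m , M) ∷ E) (merge N M x) (merge N M y)
  collapse xy with adjacent-∷⁻ xy
  ... | inj₂ (inj₁ refl) = merged-ends {N} {M} ≤-refl
  ... | inj₂ (inj₂ refl) = reach-sym (merged-ends {N} {M} ≤-refl)
  ... | inj₁ xy′ with adjacent-∷⁻ xy′
  ...   | inj₁ xy″          = merge-adjacent B there xy″
  ...   | inj₂ (inj₁ refl) = m⇝M
  ...   | inj₂ (inj₂ refl) = reach-sym m⇝M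
  expand : ∀ {x y} → Adjacent ((m , M) ∷ E) x y → Reach ((M , N) ∷ (m , N) ∷ E) x y
  expand xy with adjacent-∷⁻ xy
  ... | inj₁ xy′          = Sum.map (there ∘ there) (there ∘ there) xy′ ◅ ε
  ... | inj₂ (inj₁ refl) = inj₁ (there (here refl)) ◅ inj₂ (here refl) ◅ ε
  ... | inj₂ (inj₂ refl) = inj₁ (here refl) ◅ inj₂ (there (here refl)) ◅ ε

leaf-forest : ∀ {M u E} → Bounded M E → u ≤ M → IsForest ((u , suc M) ∷ E) ⇔ IsForest E
leaf-forest B u≤M = mk⇔ proj₂ (fresh-unreachable B u≤M ,_)

contraction-forest : ∀ {m E} → Bounded (suc m) E →
  IsForest ((suc m , suc (suc m)) ∷ (m , suc (suc m)) ∷ E) ⇔ IsForest ((m , suc m) ∷ E)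
contraction-forest {m} {E} B =
  mk⇔ (λ (¬M⇝N , _ , F) → ¬M⇝N ∘ from M⇝N⇔M⇝m ∘ reach-sym , F)
      (λ (¬m⇝M , F) → ¬m⇝M ∘ reach-sym ∘ to M⇝N⇔M⇝m , fresh-unreachable B (n≤1+n m) , F)
  where
  M⇝N⇔M⇝m : Reach ((m , suc (suc m)) ∷ E) (suc m) (suc (suc m)) ⇔ Reach E (suc m) m
  M⇝N⇔M⇝m = subst (λ v → Reach ((m , suc (suc m)) ∷ E) (suc m) (suc (suc m)) ⇔ Reach E (suc m) v)
                  (merge-target (suc (suc m)) m)
                  (merge-reach-from (leaf-merges B (n≤1+n m)) ≤-refl (suc (suc m)))

good-leaf : ∀ {M u i j E} → Bounded M E → u ≤ M → i ≤ M →
            Good (suc M) i j ((u , suc M) ∷ E) ⇔ Good M i (merge (suc M) u j) E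
good-leaf B u≤M i≤M = good-merge (leaf-merges B u≤M) u≤M i≤M (leaf-forest B u≤M)

good-contraction : ∀ {m i j E} → Bounded (suc m) E → i ≤ suc m →
  Good (suc (suc m)) i j ((suc m , suc (suc m)) ∷ (m , suc (suc m)) ∷ E) ⇔
  Good (suc m) i (merge (suc (suc m)) (suc m) j) ((m , suc m) ∷ E)
good-contraction B i≤M = good-merge (contraction-merges B) ≤-refl i≤M (contraction-forest B)


-- Counting sublists

countSublists : {A : Set} → (List A → Bool) → List A → ℕ
countSublists p L = length (filterᵇ p (sublists L))

length-filterᵇ-map : ∀ {A B : Set} (p : B → Bool) (f : A → B) xs →
                     length (filterᵇ p (map f xs)) ≡ length (filterᵇ (p ∘ f) xs)
length-filterᵇ-map p f [] = refl
length-filterᵇ-map p f (x ∷ xs) with p (f x)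
... | true  = cong suc (length-filterᵇ-map p f xs)
... | false = length-filterᵇ-map p f xs

countSublists-∷ : ∀ {A : Set} (p : List A → Bool) x L →
                  countSublists p (x ∷ L) ≡ countSublists p L + countSublists (λ s → p (x ∷ s)) L
countSublists-∷ p x L = begin
    length (filterᵇ p (sublists L ++ map (x ∷_) (sublists L)))
  ≡⟨ cong length (filter-++ (T? ∘ p) (sublists L) (map (x ∷_) (sublists L))) ⟩
    length (filterᵇ p (sublists L) ++ filterᵇ p (map (x ∷_) (sublists L)))
  ≡⟨ length-++ (filterᵇ p (sublists L)) ⟩
    countSublists p L + length (filterᵇ p (map (x ∷_) (sublists L)))
  ≡⟨ cong (countSublists p L +_) (length-filterᵇ-map p (x ∷_) (sublists L)) ⟩
    countSublists p L + countSublists (λ s → p (x ∷ s)) L ∎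
  where open ≡-Reasoning

module _ {A : Set} {Q : A → Set} where

  countSublists-cong : ∀ {p q : List A → Bool} {L} → All Q L → (∀ {s} → All Q s → p s ≡ q s) →
                       countSublists p L ≡ countSublists q L
  countSublists-cong {p} {q} {[]} [] p≗q with p [] | q [] | p≗q {[]} []
  ... | true  | true  | _ = refl
  ... | false | false | _ = refl
  countSublists-cong {p} {q} {x ∷ L} (Qx ∷ QL) p≗q = begin
      countSublists p (x ∷ L)
    ≡⟨ countSublists-∷ p x L ⟩
      countSublists p L + countSublists (λ s → p (x ∷ s)) L
    ≡⟨ cong₂ _+_ (countSublists-cong QL p≗q) (countSublists-cong QL (λ Qs → p≗q (Qx ∷ Qs))) ⟩
      countSublists q L + countSublists (λ s → q (x ∷ s)) L
    ≡⟨ countSublists-∷ q x L ⟨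
      countSublists q (x ∷ L) ∎
    where open ≡-Reasoning

  countSublists-none : ∀ {p : List A → Bool} {L} → All Q L → (∀ {s} → All Q s → p s ≡ false) →
                       countSublists p L ≡ 0
  countSublists-none {p} {L} QL p≗false = trans (countSublists-cong QL p≗false) (none L)
    where
    none : ∀ L → countSublists (λ _ → false) L ≡ 0
    none []      = refl
    none (x ∷ L) = trans (countSublists-∷ (λ _ → false) x L) (cong₂ _+_ (none L) (none L))

  PermutationInvariant : (List A → Bool) → Set
  PermutationInvariant p = ∀ {s s′} → All Q s → s ↭ s′ → p s ≡ p s′

  prefix-invariant : ∀ {p x} → Q x → PermutationInvariant p → PermutationInvariant (λ s → p (x ∷ s))
  prefix-invariant Qx p-inv Qs s↭s′ = p-inv (Qx ∷ Qs) (prep _ s↭s′)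

  countSublists-↭ : ∀ {p L L′} → PermutationInvariant p → All Q L → L ↭ L′ → countSublists p L ≡ countSublists p L′
  countSublists-↭ p-inv QL ↭.refl = refl
  countSublists-↭ {p} {x ∷ L} {x ∷ L′} p-inv (Qx ∷ QL) (prep x L↭L′) =
    trans (countSublists-∷ p x L)
    (trans (cong₂ _+_ (countSublists-↭ p-inv QL L↭L′) (countSublists-↭ (prefix-invariant Qx p-inv) QL L↭L′))
    (sym (countSublists-∷ p x L′)))
  countSublists-↭ {p} {x ∷ y ∷ L} {y ∷ x ∷ L′} p-inv (Qx ∷ Qy ∷ QL) (swap x y L↭L′) = begin
      countSublists p (x ∷ y ∷ L)
    ≡⟨ expand x y L ⟩
      (c p L + c py L) + (c px L + c pxy L)
    ≡⟨ cong₂ _+_ (cong₂ _+_ (countSublists-↭ p-inv QL L↭L′) (countSublists-↭ py-inv QL L↭L′))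
                 (cong₂ _+_ (countSublists-↭ px-inv QL L↭L′) xy⇒yx) ⟩
      (c p L′ + c py L′) + (c px L′ + c pyx L′)
    ≡⟨ interchange (c p L′) (c py L′) (c px L′) (c pyx L′) ⟩
      (c p L′ + c px L′) + (c py L′ + c pyx L′)
    ≡⟨ expand y x L′ ⟨
      countSublists p (y ∷ x ∷ L′) ∎
    where
    open ≡-Reasoning
    c = countSublists
    px = λ s → p (x ∷ s)
    py = λ s → p (y ∷ s)
    pxy = λ s → p (x ∷ y ∷ s)
    pyx = λ s → p (y ∷ x ∷ s)
    px-inv = prefix-invariant Qx p-inv
    py-inv = prefix-invariant Qy p-inv
    expand : ∀ a b L → c p (a ∷ b ∷ L) ≡
                       (c p L + c (λ s → p (b ∷ s)) L) + (c (λ s → p (a ∷ s)) L + c (λ s → p (a ∷ b ∷ s)) L)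
    expand a b L = trans (countSublists-∷ p a (b ∷ L))
                         (cong₂ _+_ (countSublists-∷ p b L) (countSublists-∷ (λ s → p (a ∷ s)) b L))
    xy⇒yx : c pxy L ≡ c pyx L′
    xy⇒yx = trans (countSublists-↭ (prefix-invariant Qy px-inv) QL L↭L′)
                  (countSublists-cong (All-resp-↭ L↭L′ QL) (λ Qs → p-inv (Qx ∷ Qy ∷ Qs) (swap x y ↭.refl)))
  countSublists-↭ p-inv QL (↭.trans L↭L′ L′↭L″) =
    trans (countSublists-↭ p-inv QL L↭L′) (countSublists-↭ p-inv (All-resp-↭ L↭L′ QL) L′↭L″)


-- The recurrence on the strip graph

topEdge : ℕ → Edge
topEdge n = (pred n , n)

lowerEdges : ℕ → List Edge
lowerEdges zero          = []
lowerEdges (suc zero)    = []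
lowerEdges (suc (suc m)) = (m , suc (suc m)) ∷ topEdge (suc m) ∷ lowerEdges (suc m)

stripEdges : ℕ → List Edge
stripEdges n = topEdge n ∷ lowerEdges n

map-upTo-∷ʳ : ∀ {A : Set} (f : ℕ → A) n → map f (upTo (suc n)) ≡ map f (upTo n) ∷ʳ f n
map-upTo-∷ʳ f n = trans (cong (map f) (sym (upTo-∷ʳ n))) (map-++ f (upTo n) (n ∷ []))

∷ʳ-++-∷ʳ-↭ : ∀ {A : Set} (X Y : List A) a b → (X ∷ʳ a) ++ (Y ∷ʳ b) ↭ a ∷ b ∷ X ++ Y
∷ʳ-++-∷ʳ-↭ X Y a b = ↭.trans (++⁺ (↭-sym (∷↭∷ʳ a X)) (↭-sym (∷↭∷ʳ b Y))) (prep a (shift b X Y))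

edges-↭-stripEdges : ∀ m → edges (suc m) ↭ stripEdges (suc m)
edges-↭-stripEdges zero    = ↭.refl
edges-↭-stripEdges (suc m) =
  ↭.trans (↭.↭-reflexive (cong₂ _++_ (map-upTo-∷ʳ short (suc m)) (map-upTo-∷ʳ long m)))
  (↭.trans (∷ʳ-++-∷ʳ-↭ (map short (upTo (suc m))) (map long (upTo m)) (short (suc m)) (long m))
  (prep _ (prep _ (edges-↭-stripEdges m))))
  where
  short long : ℕ → Edge
  short i = i , suc i
  long i = i , suc (suc i)

stripEdges-bounded : ∀ m → Bounded (suc m) (stripEdges (suc m))
stripEdges-bounded zero    = (z≤n , ≤-refl) ∷ []
stripEdges-bounded (suc m) = (n≤1+n _ , ≤-refl) ∷ leaf-bounded (n≤1+n m) (stripEdges-bounded m)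

good-invariant : ∀ n i j → PermutationInvariant {Q = BoundedEdge n} (good n i j)
good-invariant n i j Bs s↭s′ = good-≡ Bs (All-resp-↭ s↭s′ Bs) (mk⇔ (good-↭ s↭s′) (good-↭ (↭-sym s↭s′)))

forests : ℕ → ℕ → ℕ
forests n k = countSublists (good n 1 k) (stripEdges n)

forestsThroughTop : ℕ → ℕ → ℕ
forestsThroughTop n k = countSublists (λ F → good n 1 k (topEdge n ∷ F)) (lowerEdges n)

kappa≡forests : ∀ m k → kappa (suc m) 1 k ≡ forests (suc m) k
kappa≡forests m k = countSublists-↭ (good-invariant (suc m) 1 k)
  (All-resp-↭ (↭-sym (edges-↭-stripEdges m)) (stripEdges-bounded m)) (edges-↭-stripEdges m)

module _ (m k : ℕ) where
  private
    M = suc m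
    N = suc M
    B = stripEdges-bounded m

  forests-step :
    forests N k ≡ forests M (merge N m k) + forestsThroughTop N k
  forests-step = begin
      forests N k
    ≡⟨ countSublists-∷ (good N 1 k) (M , N) ((m , N) ∷ stripEdges M) ⟩
      countSublists (good N 1 k) ((m , N) ∷ stripEdges M) + forestsThroughTop N k
    ≡⟨ cong (_+ forestsThroughTop N k) (countSublists-∷ (good N 1 k) (m , N) (stripEdges M)) ⟩
      (countSublists (good N 1 k) (stripEdges M)
        + countSublists (λ F → good N 1 k ((m , N) ∷ F)) (stripEdges M)) + forestsThroughTop N k
    ≡⟨ cong (_+ forestsThroughTop N k)
         (cong₂ _+_ (countSublists-none B isolated) (countSublists-cong B deleted)) ⟩
      forests M (merge N m k) + forestsThroughTop N k ∎
    where
    open ≡-Reasoning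
    isolated : ∀ {F} → Bounded M F → good N 1 k F ≡ false
    isolated BF = good-false (bounded-weaken (n≤1+n M) BF) (isolated-not-good BF (s≤s z≤n))
    deleted : ∀ {F} → Bounded M F → good N 1 k ((m , N) ∷ F) ≡ good M 1 (merge N m k) F
    deleted BF = good-≡ (leaf-bounded (n≤1+n m) BF) BF (good-leaf BF (n≤1+n m) (s≤s z≤n))

  forestsThroughTop-step :
    forestsThroughTop N k ≡ forests M (merge N M k) + forestsThroughTop M (merge N M k)
  forestsThroughTop-step = begin
      forestsThroughTop N k
    ≡⟨ countSublists-∷ (λ F → good N 1 k ((M , N) ∷ F)) (m , N) (stripEdges M) ⟩
      countSublists (λ F → good N 1 k ((M , N) ∷ F)) (stripEdges M)
        + countSublists (λ F → good N 1 k ((M , N) ∷ (m , N) ∷ F)) (stripEdges M)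
    ≡⟨ cong₂ _+_ (countSublists-cong B deleted) (countSublists-cong B contracted) ⟩
      forests M k′ + countSublists (λ F → good M 1 k′ ((m , M) ∷ F)) ((m , M) ∷ lowerEdges M)
    ≡⟨ cong (forests M k′ +_) (countSublists-∷ (λ F → good M 1 k′ ((m , M) ∷ F)) (m , M) (lowerEdges M)) ⟩
      forests M k′ + (forestsThroughTop M k′
        + countSublists (λ F → good M 1 k′ ((m , M) ∷ (m , M) ∷ F)) (lowerEdges M))
    ≡⟨ cong (λ x → forests M k′ + (forestsThroughTop M k′ + x)) (countSublists-none (All.tail B) doubled) ⟩
      forests M k′ + (forestsThroughTop M k′ + 0)
    ≡⟨ cong (forests M k′ +_) (+-identityʳ _) ⟩
      forests M k′ + forestsThroughTop M k′ ∎
    where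
    open ≡-Reasoning
    k′ = merge N M k
    mM-bounded : BoundedEdge M (m , M)
    mM-bounded = n≤1+n m , ≤-refl
    deleted : ∀ {F} → Bounded M F → good N 1 k ((M , N) ∷ F) ≡ good M 1 k′ F
    deleted BF = good-≡ (leaf-bounded ≤-refl BF) BF (good-leaf BF ≤-refl (s≤s z≤n))
    contracted : ∀ {F} → Bounded M F → good N 1 k ((M , N) ∷ (m , N) ∷ F) ≡ good M 1 k′ ((m , M) ∷ F)
    contracted BF = good-≡ ((n≤1+n M , ≤-refl) ∷ leaf-bounded (n≤1+n m) BF) (mM-bounded ∷ BF)
                           (good-contraction BF (s≤s z≤n))
    doubled : ∀ {F} → Bounded M F → good M 1 k′ ((m , M) ∷ (m , M) ∷ F) ≡ false
    doubled BF = good-false (mM-bounded ∷ mM-bounded ∷ BF) (doubled-not-forest ∘ proj₁)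


-- Fibonacci closed forms

closedForm : ℕ → ℕ → ℕ
closedForm n k = fib k * fib (2 * n ∸ k)

closedFormTop : ℕ → ℕ → ℕ
closedFormTop n k = fib k * fib (2 * n ∸ k ∸ 1)

fib-suc : ∀ j → 0 < j → fib (suc j) ≡ fib j + fib (j ∸ 1)
fib-suc (suc i) _ = refl

double-suc-∸ : ∀ n k → k ≤ 2 * n → 2 * suc n ∸ k ≡ suc (suc (2 * n ∸ k))
double-suc-∸ n k k≤2n = trans (cong (_∸ k) (*-suc 2 n)) (+-∸-assoc 2 k≤2n)

double-∸-self : ∀ n → 2 * n ∸ n ≡ n
double-∸-self n = trans (m+n∸m≡n n (n + 0)) (+-identityʳ n)

module _ (m : ℕ) where
  private
    M = suc m
    N = suc M

  module _ {k : ℕ} (k≤M : k ≤ M) where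
    private
      j = 2 * M ∸ k
      j>0 : 0 < j
      j>0 = m<n⇒0<n∸m (≤-<-trans k≤M (m<m+n M z<s))
      2N∸k : 2 * N ∸ k ≡ suc (suc j)
      2N∸k = double-suc-∸ M k (≤-trans k≤M (m≤m+n M _))

    closedFormTop-below : closedFormTop N k ≡ closedForm M k + closedFormTop M k
    closedFormTop-below = begin
        fib k * fib (2 * N ∸ k ∸ 1)
      ≡⟨ cong (λ i → fib k * fib (i ∸ 1)) 2N∸k ⟩
        fib k * fib (suc j)
      ≡⟨ cong (fib k *_) (fib-suc j j>0) ⟩
        fib k * (fib j + fib (j ∸ 1))
      ≡⟨ *-distribˡ-+ (fib k) (fib j) (fib (j ∸ 1)) ⟩
        closedForm M k + closedFormTop M k ∎
      where open ≡-Reasoning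

    closedForm-below : closedForm N k ≡ closedForm M k + closedFormTop N k
    closedForm-below = begin
        fib k * fib (2 * N ∸ k)
      ≡⟨ cong (λ i → fib k * fib i) 2N∸k ⟩
        fib k * (fib (suc j) + fib j)
      ≡⟨ *-distribˡ-+ (fib k) (fib (suc j)) (fib j) ⟩
        fib k * fib (suc j) + fib k * fib j
      ≡⟨ +-comm (fib k * fib (suc j)) (fib k * fib j) ⟩
        fib k * fib j + fib k * fib (suc j)
      ≡⟨ cong (λ i → closedForm M k + fib k * fib (i ∸ 1)) 2N∸k ⟨
        closedForm M k + closedFormTop N k ∎
      where open ≡-Reasoning

  closedFormTop-top : closedFormTop N N ≡ closedForm M M + closedFormTop M M
  closedFormTop-top = begin
      fib N * fib (2 * N ∸ N ∸ 1)
    ≡⟨ cong (λ i → fib N * fib (i ∸ 1)) (double-∸-self N) ⟩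
      fib N * fib M
    ≡⟨ *-comm (fib N) (fib M) ⟩
      fib M * (fib M + fib m)
    ≡⟨ *-distribˡ-+ (fib M) (fib M) (fib m) ⟩
      fib M * fib M + fib M * fib m
    ≡⟨ cong (λ i → fib M * fib i + fib M * fib (i ∸ 1)) (double-∸-self M) ⟨
      closedForm M M + closedFormTop M M ∎
    where open ≡-Reasoning

  closedForm-top : closedForm N N ≡ closedForm M m + closedFormTop N N
  closedForm-top = begin
      fib N * fib (2 * N ∸ N)
    ≡⟨ cong (λ i → fib N * fib i) (double-∸-self N) ⟩
      fib N * (fib M + fib m)
    ≡⟨ *-distribˡ-+ (fib N) (fib M) (fib m) ⟩
      fib N * fib M + fib N * fib m
    ≡⟨ +-comm (fib N * fib M) (fib N * fib m) ⟩
      fib N * fib m + fib N * fib M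
    ≡⟨ cong (_+ fib N * fib M) (*-comm (fib N) (fib m)) ⟩
      fib m * fib N + fib N * fib M
    ≡⟨ cong₂ (λ i i′ → fib m * fib i + fib N * fib (i′ ∸ 1)) 2M∸m (double-∸-self N) ⟨
      closedForm M m + closedFormTop N N ∎
    where
    open ≡-Reasoning
    2M∸m : 2 * M ∸ m ≡ N
    2M∸m = trans (double-suc-∸ m m (m≤m+n m _)) (cong (suc ∘ suc) (double-∸-self m))

  closedFormTop-step : ∀ k → k ≤ N →
                       closedFormTop N k ≡ closedForm M (merge N M k) + closedFormTop M (merge N M k)
  closedFormTop-step k k≤N with k ≟ N
  ... | yes refl rewrite merge-target N M = closedFormTop-top
  ... | no  k≢N  rewrite merge-fixed {t = M} (≤∧≢⇒< k≤N k≢N) = closedFormTop-below (s≤s⁻¹ (≤∧≢⇒< k≤N k≢N))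

  closedForm-step : ∀ k → k ≤ N → closedForm N k ≡ closedForm M (merge N m k) + closedFormTop N k
  closedForm-step k k≤N with k ≟ N
  ... | yes refl rewrite merge-target N m = closedForm-top
  ... | no  k≢N  rewrite merge-fixed {t = m} (≤∧≢⇒< k≤N k≢N) = closedForm-below (s≤s⁻¹ (≤∧≢⇒< k≤N k≢N))

forests-closedForm : ∀ m k → k ≤ suc m →
  forests (suc m) k ≡ closedForm (suc m) k × forestsThroughTop (suc m) k ≡ closedFormTop (suc m) k
forests-closedForm zero zero          _ = refl , refl
forests-closedForm zero (suc zero)    _ = refl , refl
forests-closedForm zero (suc (suc k)) (s≤s ())
forests-closedForm (suc m) k k≤N = forests≡ , through≡
  where
  M = suc m
  N = suc M
  IH₁ = forests-closedForm m (merge N m k) (merge-≤ (n≤1+n m) k≤N)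
  IH₂ = forests-closedForm m (merge N M k) (merge-≤ ≤-refl k≤N)
  through≡ : forestsThroughTop N k ≡ closedFormTop N k
  through≡ = begin
      forestsThroughTop N k
    ≡⟨ forestsThroughTop-step m k ⟩
      forests M (merge N M k) + forestsThroughTop M (merge N M k)
    ≡⟨ cong₂ _+_ (proj₁ IH₂) (proj₂ IH₂) ⟩
      closedForm M (merge N M k) + closedFormTop M (merge N M k)
    ≡⟨ closedFormTop-step m k k≤N ⟨
      closedFormTop N k ∎
    where open ≡-Reasoning
  forests≡ : forests N k ≡ closedForm N k
  forests≡ = begin
      forests N k
    ≡⟨ forests-step m k ⟩
      forests M (merge N m k) + forestsThroughTop N k
    ≡⟨ cong₂ _+_ (proj₁ IH₁) through≡ ⟩
      closedForm M (merge N m k) + closedFormTop N k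
    ≡⟨ closedForm-step m k k≤N ⟨
      closedForm N k ∎
    where open ≡-Reasoning

lemma5p2 : (n : ℕ) → 1 ≤ n → (k : ℕ) → k ≤ n →
    kappa n 1 k ≡ fib k * fib (2 * n ∸ k)
lemma5p2 (suc m) _ k k≤n = trans (kappa≡forests m k) (proj₁ (forests-closedForm m k k≤n))
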